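{- Call a positive integer $m$ totally balanced if its binary expansion (without leading zeros) has even length $2k$, contains exactly $k$ ones and $k$ zeros, and, reading from the most significant bit, every prefix contains at least as many ones as zeros. For a positive integer $m$ with binary expansion $m = \sum_{j=0}^{L-1} \beta_j 2^j$ ($\beta_j \in \{0,1\}$), let $v_m = \sum_{j=0}^{L-1} \beta_j 2^{ -j-1}$ (the base-2 van der Corput sequence). Then for every totally balanced $m$, the denominator of $v_m$ written in lowest terms is a power of $4$; moreover, for each $k \geq 1$, the number of totally balanced integers $m$ for which the reduced denominator of $v_m$ equals $4^k$ is exactly the Catalan number $$C_k = \frac{1}{k+1}\binom{2k}{k}.$$ -}

module Defs where

open import Data.Nat using (ℕ; zero; suc; _+_; _*_; _^_; _≤_; _<_; _%_; _/_; NonZero)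
open import Data.Nat.Properties using (m^n≢0)
open import Data.List using (List; []; _∷_; length; reverse; take; filter)
open import Data.Product using (∃; _×_)
open import Relation.Binary.PropositionalEquality using (_≡_)
open import Relation.Nullary.Decidable using (Dec)
import Data.Nat as ℕ
open import Data.Integer using (+_)
open import Data.Rational using (ℚ; 0ℚ) renaming (_+_ to _+ℚ_; _/_ to _/ℚ_)

-- Binary digits of n, least significant first (β₀ ∷ β₁ ∷ …), without
-- leading zeros; 0 has the empty expansion.  The first argument is fuel
-- (n steps always suffice, since n / 2 < n for n > 0).
bitsAux : ℕ → ℕ → List ℕ
bitsAux zero    n       = []
bitsAux (suc f) zero    = []
bitsAux (suc f) (suc n) = (suc n % 2) ∷ bitsAux f (suc n / 2)

bitsLSB : ℕ → List ℕ
bitsLSB n = bitsAux n n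

bitsMSB : ℕ → List ℕ
bitsMSB n = reverse (bitsLSB n)

ones : List ℕ → ℕ
ones []       = 0
ones (b ∷ bs) = b + ones bs

zeros : List ℕ → ℕ
zeros []       = 0
zeros (zero ∷ bs)  = suc (zeros bs)
zeros (suc _ ∷ bs) = zeros bs

TotallyBalanced : ℕ → Set
TotallyBalanced m =
  1 ≤ m ×
  ∃ λ k → length (bitsMSB m) ≡ 2 * k
        × ones (bitsMSB m) ≡ k
        × zeros (bitsMSB m) ≡ k
        × (∀ i → zeros (take i (bitsMSB m)) ≤ ones (take i (bitsMSB m)))

vdcSum : ℕ → List ℕ → ℚ
vdcSum j []       = 0ℚ
vdcSum j (b ∷ bs) = ((+ b) /ℚ (2 ^ suc j)) {{m^n≢0 2 (suc j)}} +ℚ vdcSum (suc j) bs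

vdc : ℕ → ℚ
vdc m = vdcSum 0 (bitsLSB m)

open import Data.Nat.Combinatorics using (_C_)
catalan : ℕ → ℕ
catalan k = ((2 * k) C k) ℕ./ suc k

-- The van der Corput value of m is r / 2^L, where L is the binary length of m and r is the
-- number with the binary digits of m reversed. The leading digit of m is 1, so r is odd and
-- the reduced denominator is exactly 2^L, which is 4^k when m is totally balanced of length
-- 2k. Conversely the denominator 4^k forces L = 2k, so the numbers to count are those whose
-- binary expansion is a Dyck word of semilength k. Read from the least significant digit,
-- such words are ballot paths; splitting these by their last step, Pascal's rule gives the
-- ballot formula for paths ending at any height, which at height 0 reads
-- (k + 1) * #paths = C(2k, k).

module Submission where

open import Defs
open import Algebra.Properties.CommutativeSemigroup using (interchange)
import Data.Integer as ℤ
import Data.Integer.Properties as ℤ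
open import Data.List using (List; []; _∷_; [_]; _++_; _∷ʳ_; length; map; reverse; take)
open import Data.List.Membership.Propositional using (_∈_)
open import Data.List.Membership.Propositional.Properties using (∈-map⁺; ∈-map⁻; ∈-++⁺ˡ; ∈-++⁺ʳ; ∈-++⁻)
open import Data.List.Properties
  using (unfold-reverse; length-reverse; length-map; length-++; take-[]; take-all; map-∘; map-id-local; ∷-injectiveˡ; ∷-injectiveʳ)
open import Data.List.Relation.Unary.All as All using (All; []; _∷_)
open import Data.List.Relation.Unary.Any using (here)
open import Data.List.Relation.Unary.AllPairs using ([]; _∷_)
open import Data.List.Relation.Binary.Disjoint.Propositional using (Disjoint)
open import Data.List.Relation.Unary.Unique.Propositional using (Unique)
import Data.List.Relation.Unary.Unique.Propositional.Properties as Unique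
open import Data.Nat
open import Data.Nat.Combinatorics using (_C_; nCk≡n!/k![n-k]!; k![n∸k]!∣n!; [n-k]*[n-k-1]!≡[n-k]!; k>n⇒nCk≡0; nCk+nC[k+1]≡[n+1]C[k+1])
open import Data.Nat.Coprimality as Coprime using (Coprime; coprime-divisor; coprime⇒gcd≡1; 1-coprimeTo)
open import Data.Nat.Divisibility using (∣1⇒≡1; ∣-trans; n∣m*n; n∣m⇒m%n≡0)
open import Data.Nat.DivMod
  using (m≡m%n+[m/n]*n; m%n<n; [m+kn]%n≡m%n; m<n⇒m%n≡m; m<n⇒m/n≡0; m/n≡0⇒m<n; m/n<m; m*n/n≡m; m/n*n≡m; +-distrib-/-∣ʳ)
open import Data.Nat.GCD using (gcd)
open import Data.Nat.Primality using (prime[2]; prime⇒irreducible)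
open import Data.Nat.Properties
open import Data.Nat.Tactic.RingSolver using (solve-∀)
open import Data.Product using (Σ; ∃; _×_; _,_)
open import Data.Rational using (↧_; ↧ₙ_; toℚᵘ) renaming (_/_ to _/ℚ_)
import Data.Rational.Properties as ℚ
open import Data.Rational.Unnormalised using (mkℚᵘ; *≡*) renaming (_≃_ to _≃ᵘ_; _+_ to _+ᵘ_)
import Data.Rational.Unnormalised.Properties as ℚᵘ
open import Data.Sum using (_⊎_; inj₁; inj₂)
import Data.Sum as Sum
open import Function using (_∘_)
open import Function.Bundles using (_⇔_; mk⇔)
open import Relation.Binary.Definitions using (tri<; tri≈; tri>)
open import Relation.Binary.PropositionalEquality using (_≡_; _≢_; refl; sym; trans; cong; cong₂; subst; subst₂; module ≡-Reasoning)
open import Relation.Nullary using (yes; no; contradiction)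

reverse-invariant : (f : List ℕ → ℕ) → (∀ xs ys → f (xs ++ ys) ≡ f xs + f ys) →
                    ∀ w → f (reverse w) ≡ f w
reverse-invariant f f-++ []      = refl
reverse-invariant f f-++ (x ∷ w) = begin
  f (reverse (x ∷ w))     ≡⟨ cong f (unfold-reverse x w) ⟩
  f (reverse w ++ [ x ])  ≡⟨ f-++ (reverse w) [ x ] ⟩
  f (reverse w) + f [ x ] ≡⟨ cong (_+ f [ x ]) (reverse-invariant f f-++ w) ⟩
  f w + f [ x ]           ≡⟨ +-comm (f w) (f [ x ]) ⟩
  f [ x ] + f w           ≡⟨ f-++ [ x ] w ⟨
  f (x ∷ w)               ∎
  where open ≡-Reasoning

ones-++ : ∀ xs ys → ones (xs ++ ys) ≡ ones xs + ones ys
ones-++ []       ys = refl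
ones-++ (x ∷ xs) ys = trans (cong (x +_) (ones-++ xs ys)) (sym (+-assoc x (ones xs) (ones ys)))

zeros-++ : ∀ xs ys → zeros (xs ++ ys) ≡ zeros xs + zeros ys
zeros-++ []           ys = refl
zeros-++ (zero ∷ xs)  ys = cong suc (zeros-++ xs ys)
zeros-++ (suc _ ∷ xs) ys = zeros-++ xs ys

ones-reverse : ∀ w → ones (reverse w) ≡ ones w
ones-reverse = reverse-invariant ones ones-++

zeros-reverse : ∀ w → zeros (reverse w) ≡ zeros w
zeros-reverse = reverse-invariant zeros zeros-++

take-∷ʳ : ∀ {A : Set} i (xs : List A) x →
          take i (xs ∷ʳ x) ≡ take i xs ⊎ take i (xs ∷ʳ x) ≡ xs ∷ʳ x
take-∷ʳ zero    xs       x = inj₁ refl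
take-∷ʳ (suc i) []       x = inj₂ (cong (x ∷_) (take-[] i))
take-∷ʳ (suc i) (y ∷ xs) x = Sum.map (cong (y ∷_)) (cong (y ∷_)) (take-∷ʳ i xs x)

take-++-⊓ : ∀ {A : Set} i (xs ys : List A) → take i xs ≡ take (i ⊓ length xs) (xs ++ ys)
take-++-⊓ zero    xs       ys = refl
take-++-⊓ (suc i) []       ys = refl
take-++-⊓ (suc i) (x ∷ xs) ys = cong (x ∷_) (take-++-⊓ i xs ys)

-- Digit words read most significant digit first

Nonnegative : List ℕ → Set
Nonnegative u = zeros u ≤ ones u

PrefixNonnegative : List ℕ → Set
PrefixNonnegative u = ∀ i → Nonnegative (take i u)

Dyck : ℕ → List ℕ → Set
Dyck k u = length u ≡ 2 * k × ones u ≡ k × zeros u ≡ k × PrefixNonnegative u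

nonnegative-reverse⁻ : ∀ w → Nonnegative (reverse w) → Nonnegative w
nonnegative-reverse⁻ w = subst₂ _≤_ (zeros-reverse w) (ones-reverse w)

nonnegative-reverse⁺ : ∀ w → Nonnegative w → Nonnegative (reverse w)
nonnegative-reverse⁺ w = subst₂ _≤_ (sym (zeros-reverse w)) (sym (ones-reverse w))

prefixNonnegative-[] : PrefixNonnegative []
prefixNonnegative-[] i rewrite take-[] {A = ℕ} i = z≤n

prefixNonnegative⇒nonnegative : ∀ {u} → PrefixNonnegative u → Nonnegative u
prefixNonnegative⇒nonnegative {u} pn = subst Nonnegative (take-all (length u) u ≤-refl) (pn (length u))

prefixNonnegative-∷ʳ⁻ : ∀ {u x} → PrefixNonnegative (u ∷ʳ x) → PrefixNonnegative u
prefixNonnegative-∷ʳ⁻ {u} {x} pn i =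
  subst Nonnegative (sym (take-++-⊓ i u [ x ])) (pn (i ⊓ length u))

prefixNonnegative-∷ʳ⁺ : ∀ {u x} → PrefixNonnegative u → Nonnegative (u ∷ʳ x) →
                        PrefixNonnegative (u ∷ʳ x)
prefixNonnegative-∷ʳ⁺ {u} {x} pn nn i with take-∷ʳ i u x
... | inj₁ eq = subst Nonnegative (sym eq) (pn i)
... | inj₂ eq = subst Nonnegative (sym eq) nn

prefixNonnegative-reverse-∷⁻ : ∀ x w → PrefixNonnegative (reverse (x ∷ w)) →
                               PrefixNonnegative (reverse w)
prefixNonnegative-reverse-∷⁻ x w pn =
  prefixNonnegative-∷ʳ⁻ (subst PrefixNonnegative (unfold-reverse x w) pn)

prefixNonnegative-reverse-∷⁺ : ∀ x w → PrefixNonnegative (reverse w) → Nonnegative (x ∷ w) →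
                               PrefixNonnegative (reverse (x ∷ w))
prefixNonnegative-reverse-∷⁺ x w pn nn = subst PrefixNonnegative (sym (unfold-reverse x w))
  (prefixNonnegative-∷ʳ⁺ pn
    (subst Nonnegative (unfold-reverse x w) (nonnegative-reverse⁺ (x ∷ w) nn)))

-- Binary numerals, least significant digit first

fromBits : List ℕ → ℕ
fromBits []       = 0
fromBits (b ∷ bs) = b + fromBits bs * 2

data IsBit : ℕ → Set where
  bit0 : IsBit 0
  bit1 : IsBit 1

data Numeral : List ℕ → Set where
  []  : Numeral []
  [1] : Numeral (1 ∷ [])
  _∷_ : ∀ {b x xs} → IsBit b → Numeral (x ∷ xs) → Numeral (b ∷ x ∷ xs)

isBit⇒<2 : ∀ {b} → IsBit b → b < 2
isBit⇒<2 bit0 = s≤s z≤n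
isBit⇒<2 bit1 = s≤s (s≤s z≤n)

n%2-isBit : ∀ n → IsBit (n % 2)
n%2-isBit n with n % 2 | m%n<n n 2
... | 0           | _                = bit0
... | 1           | _                = bit1
... | suc (suc _) | s≤s (s≤s ())

[b+t*2]%2≡b : ∀ {b} → IsBit b → ∀ t → (b + t * 2) % 2 ≡ b
[b+t*2]%2≡b {b} β t = trans ([m+kn]%n≡m%n b t 2) (m<n⇒m%n≡m (isBit⇒<2 β))

[b+t*2]/2≡t : ∀ {b} → IsBit b → ∀ t → (b + t * 2) / 2 ≡ t
[b+t*2]/2≡t {b} β t =
  trans (+-distrib-/-∣ʳ b (n∣m*n t)) (cong₂ _+_ (m<n⇒m/n≡0 (isBit⇒<2 β)) (m*n/n≡m t 2))

numeral⇒bits : ∀ {w} → Numeral w → All IsBit w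
numeral⇒bits []      = []
numeral⇒bits [1]     = bit1 ∷ []
numeral⇒bits (β ∷ ν) = β ∷ numeral⇒bits ν

length≡ones+zeros : ∀ {w} → All IsBit w → length w ≡ ones w + zeros w
length≡ones+zeros []                  = refl
length≡ones+zeros (bit1 ∷ βs)         = cong suc (length≡ones+zeros βs)
length≡ones+zeros {_ ∷ w} (bit0 ∷ βs) =
  trans (cong suc (length≡ones+zeros βs)) (sym (+-suc (ones w) (zeros w)))

fromBits-pos : ∀ {x xs} → Numeral (x ∷ xs) → 0 < fromBits (x ∷ xs)
fromBits-pos [1]         = s≤s z≤n
fromBits-pos {b} (_ ∷ ν) = ≤-trans (fromBits-pos ν) (≤-trans (m≤m*n _ 2) (m≤n+m _ b))

[1+n]/2≤n : ∀ n → suc n / 2 ≤ n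
[1+n]/2≤n n = s≤s⁻¹ (m/n<m (suc n) 2 (s≤s (s≤s z≤n)))

[1+n]/2≡0⇒[1+n]%2≡1 : ∀ n → suc n / 2 ≡ 0 → suc n % 2 ≡ 1
[1+n]/2≡0⇒[1+n]%2≡1 zero    _   = refl
[1+n]/2≡0⇒[1+n]%2≡1 (suc n) q≡0 =
  contradiction (m/n≡0⇒m<n {suc (suc n)} {2} q≡0) λ { (s≤s (s≤s ())) }

bitsAux-fuel : ∀ {f g n} → n ≤ f → n ≤ g → bitsAux f n ≡ bitsAux g n
bitsAux-fuel {zero}  {zero}  z≤n z≤n = refl
bitsAux-fuel {zero}  {suc _} z≤n z≤n = refl
bitsAux-fuel {suc _} {zero}  z≤n z≤n = refl
bitsAux-fuel {suc _} {suc _} z≤n z≤n = refl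
bitsAux-fuel {suc f} {suc g} {suc n} (s≤s n≤f) (s≤s n≤g) =
  cong (suc n % 2 ∷_) (bitsAux-fuel (≤-trans ([1+n]/2≤n n) n≤f) (≤-trans ([1+n]/2≤n n) n≤g))

bitsLSB-step : ∀ {n} → 0 < n → bitsLSB n ≡ n % 2 ∷ bitsLSB (n / 2)
bitsLSB-step {suc n} _ = cong (suc n % 2 ∷_) (bitsAux-fuel ([1+n]/2≤n n) ≤-refl)

fromBits-bitsAux : ∀ f {n} → n ≤ f → fromBits (bitsAux f n) ≡ n
fromBits-bitsAux zero    {zero}  _         = refl
fromBits-bitsAux (suc f) {zero}  _         = refl
fromBits-bitsAux (suc f) {suc n} (s≤s n≤f) = begin
  suc n % 2 + fromBits (bitsAux f (suc n / 2)) * 2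
    ≡⟨ cong (λ q → suc n % 2 + q * 2) (fromBits-bitsAux f (≤-trans ([1+n]/2≤n n) n≤f)) ⟩
  suc n % 2 + suc n / 2 * 2
    ≡⟨ m≡m%n+[m/n]*n (suc n) 2 ⟨
  suc n ∎
  where open ≡-Reasoning

numeral-bitsAux : ∀ f {n} → n ≤ f → Numeral (bitsAux f n)
numeral-bitsAux zero    {zero}  _         = []
numeral-bitsAux (suc f) {zero}  _         = []
numeral-bitsAux (suc f) {suc n} (s≤s n≤f)
  with bitsAux f (suc n / 2) | numeral-bitsAux f q≤f | fromBits-bitsAux f q≤f
  where
  q≤f : suc n / 2 ≤ f
  q≤f = ≤-trans ([1+n]/2≤n n) n≤f
... | _ ∷ _ | ν | _   = n%2-isBit (suc n) ∷ ν
... | []    | _ | 0≡q =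
  subst (λ d → Numeral (d ∷ [])) (sym ([1+n]/2≡0⇒[1+n]%2≡1 n (sym 0≡q))) [1]

fromBits-bitsLSB : ∀ n → fromBits (bitsLSB n) ≡ n
fromBits-bitsLSB n = fromBits-bitsAux n ≤-refl

numeral-bitsLSB : ∀ n → Numeral (bitsLSB n)
numeral-bitsLSB n = numeral-bitsAux n ≤-refl

bitsLSB-fromBits : ∀ {w} → Numeral w → bitsLSB (fromBits w) ≡ w
bitsLSB-fromBits []  = refl
bitsLSB-fromBits [1] = refl
bitsLSB-fromBits {b ∷ w} (β ∷ ν) = begin
  bitsLSB (b + t * 2)
    ≡⟨ bitsLSB-step (fromBits-pos (β ∷ ν)) ⟩
  (b + t * 2) % 2 ∷ bitsLSB ((b + t * 2) / 2)
    ≡⟨ cong₂ _∷_ ([b+t*2]%2≡b β t) (cong bitsLSB ([b+t*2]/2≡t β t)) ⟩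
  b ∷ bitsLSB t
    ≡⟨ cong (b ∷_) (bitsLSB-fromBits ν) ⟩
  b ∷ w ∎
  where
  open ≡-Reasoning
  t = fromBits w

-- Denominators of van der Corput values

fromBitsMSB : List ℕ → ℕ
fromBitsMSB []       = 0
fromBitsMSB (b ∷ bs) = b * 2 ^ length bs + fromBitsMSB bs

fromBitsMSB-odd : ∀ {x xs} → Numeral (x ∷ xs) → fromBitsMSB (x ∷ xs) % 2 ≡ 1
fromBitsMSB-odd [1] = refl
fromBitsMSB-odd {b} {x ∷ xs} (_ ∷ ν) = begin
  (b * (2 * q) + r) % 2 ≡⟨ cong (λ s → (s + r) % 2) b*[2*q]≡b*q*2 ⟩
  (b * q * 2 + r) % 2   ≡⟨ cong (_% 2) (+-comm (b * q * 2) r) ⟩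
  (r + b * q * 2) % 2   ≡⟨ [m+kn]%n≡m%n r (b * q) 2 ⟩
  r % 2                 ≡⟨ fromBitsMSB-odd ν ⟩
  1                     ∎
  where
  open ≡-Reasoning
  q = 2 ^ length xs
  r = fromBitsMSB (x ∷ xs)
  b*[2*q]≡b*q*2 : b * (2 * q) ≡ b * q * 2
  b*[2*q]≡b*q*2 = trans (cong (b *_) (*-comm 2 q)) (sym (*-assoc b q 2))

odd⇒coprime-2 : ∀ {n} → n % 2 ≡ 1 → Coprime n 2
odd⇒coprime-2 {n} odd (d∣n , d∣2) with prime⇒irreducible prime[2] d∣2
... | inj₁ d≡1  = d≡1
... | inj₂ refl = contradiction (trans (sym (n∣m⇒m%n≡0 n 2 d∣n)) odd) λ ()

coprime-^ʳ : ∀ {m n} → Coprime m n → ∀ k → Coprime m (n ^ k)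
coprime-^ʳ c zero    (_ , d∣1)      = ∣1⇒≡1 d∣1
coprime-^ʳ c (suc k) (d∣m , d∣n*nᵏ) =
  coprime-^ʳ c k (d∣m , coprime-divisor (λ (e∣d , e∣n) → c (∣-trans e∣d d∣m , e∣n)) d∣n*nᵏ)

numeral-coprime : ∀ {w} → Numeral w → Coprime (fromBitsMSB w) (2 ^ length w)
numeral-coprime {[]}        _ = Coprime.sym (1-coprimeTo 0)
numeral-coprime {w@(_ ∷ _)} ν = coprime-^ʳ (odd⇒coprime-2 (fromBitsMSB-odd ν)) (length w)

toℚᵘ-/ : ∀ n d .{{_ : NonZero d}} → toℚᵘ (ℤ.+ n /ℚ d) ≃ᵘ mkℚᵘ (ℤ.+ n) (pred d)
toℚᵘ-/ n (suc d) = ℚ.toℚᵘ-fromℚᵘ (mkℚᵘ (ℤ.+ n) d)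

+ᵘ-common-denominator : ∀ a b d₁ d₂ p → suc d₂ ≡ suc d₁ * p →
  mkℚᵘ (ℤ.+ a) d₁ +ᵘ mkℚᵘ (ℤ.+ b) d₂ ≃ᵘ mkℚᵘ (ℤ.+ (a * p + b)) d₂
+ᵘ-common-denominator a b d₁ d₂ p D₂≡D₁*p = *≡* (begin
  (ℤ.+ a ℤ.* ℤ.+ D₂ ℤ.+ ℤ.+ b ℤ.* ℤ.+ D₁) ℤ.* ℤ.+ D₂
    ≡⟨ cong₂ (λ x y → (x ℤ.+ y) ℤ.* ℤ.+ D₂) (ℤ.pos-* a D₂) (ℤ.pos-* b D₁) ⟨
  (ℤ.+ (a * D₂) ℤ.+ ℤ.+ (b * D₁)) ℤ.* ℤ.+ D₂
    ≡⟨ cong (ℤ._* ℤ.+ D₂) (ℤ.pos-+ (a * D₂) (b * D₁)) ⟨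
  ℤ.+ (a * D₂ + b * D₁) ℤ.* ℤ.+ D₂
    ≡⟨ ℤ.pos-* (a * D₂ + b * D₁) D₂ ⟨
  ℤ.+ ((a * D₂ + b * D₁) * D₂)
    ≡⟨ cong (λ x → ℤ.+ ((a * x + b * D₁) * D₂)) D₂≡D₁*p ⟩
  ℤ.+ ((a * (D₁ * p) + b * D₁) * D₂)
    ≡⟨ cong ℤ.+_ (distribute a b p D₁ D₂) ⟩
  ℤ.+ ((a * p + b) * (D₁ * D₂))
    ≡⟨ ℤ.pos-* (a * p + b) (D₁ * D₂) ⟩
  ℤ.+ (a * p + b) ℤ.* ℤ.+ (D₁ * D₂) ∎)
  where
  open ≡-Reasoning
  D₁ = suc d₁
  D₂ = suc d₂
  distribute : ∀ a b p x y → (a * (x * p) + b * x) * y ≡ (a * p + b) * (x * y)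
  distribute = solve-∀

toℚᵘ-vdcSum : ∀ j w →
  toℚᵘ (vdcSum j w) ≃ᵘ mkℚᵘ (ℤ.+ fromBitsMSB w) (pred (2 ^ (j + length w)))
toℚᵘ-vdcSum j []       = *≡* refl
toℚᵘ-vdcSum j (b ∷ bs) = begin
  toℚᵘ (vdcSum j (b ∷ bs))
    ≈⟨ ℚ.toℚᵘ-homo-+ (ℤ.+ b /ℚ 2 ^ suc j) (vdcSum (suc j) bs) ⟩
  toℚᵘ (ℤ.+ b /ℚ 2 ^ suc j) +ᵘ toℚᵘ (vdcSum (suc j) bs)
    ≈⟨ ℚᵘ.+-cong (toℚᵘ-/ b (2 ^ suc j)) (toℚᵘ-vdcSum (suc j) bs) ⟩
  mkℚᵘ (ℤ.+ b) (pred (2 ^ suc j)) +ᵘ mkℚᵘ (ℤ.+ fromBitsMSB bs) (pred (2 ^ (suc j + n)))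
    ≈⟨ +ᵘ-common-denominator b (fromBitsMSB bs) _ _ (2 ^ n) denominators ⟩
  mkℚᵘ (ℤ.+ fromBitsMSB (b ∷ bs)) (pred (2 ^ (suc j + n)))
    ≡⟨ cong (λ e → mkℚᵘ (ℤ.+ fromBitsMSB (b ∷ bs)) (pred (2 ^ e))) (+-suc j n) ⟨
  mkℚᵘ (ℤ.+ fromBitsMSB (b ∷ bs)) (pred (2 ^ (j + length (b ∷ bs)))) ∎
  where
  open ℚᵘ.≃-Reasoning
  n = length bs
  instance
    2^[1+j]≢0 : NonZero (2 ^ suc j)
    2^[1+j]≢0 = m^n≢0 2 (suc j)
    2^[1+j+n]≢0 : NonZero (2 ^ (suc j + n))
    2^[1+j+n]≢0 = m^n≢0 2 (suc j + n)
  denominators : suc (pred (2 ^ (suc j + n))) ≡ suc (pred (2 ^ suc j)) * 2 ^ n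
  denominators = trans (suc-pred (2 ^ (suc j + n)))
    (trans (^-distribˡ-+-* 2 (suc j) n) (cong (_* 2 ^ n) (sym (suc-pred (2 ^ suc j)))))

↧ₙ-/-coprime : ∀ n d .{{_ : NonZero d}} → Coprime n d → ↧ₙ (ℤ.+ n /ℚ d) ≡ d
↧ₙ-/-coprime n d c = ℤ.+-injective (begin
  ↧ (ℤ.+ n /ℚ d)                ≡⟨ ℤ.*-identityʳ _ ⟨
  ↧ (ℤ.+ n /ℚ d) ℤ.* ℤ.+ 1       ≡⟨ cong (λ g → ↧ (ℤ.+ n /ℚ d) ℤ.* ℤ.+ g) (coprime⇒gcd≡1 c) ⟨
  ↧ (ℤ.+ n /ℚ d) ℤ.* ℤ.+ gcd n d ≡⟨ ℚ.↧-/ (ℤ.+ n) d ⟩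
  ℤ.+ d                          ∎)
  where open ≡-Reasoning

↧ₙ-≃ᵘ-coprime : ∀ {p n d} .{{_ : NonZero d}} →
                toℚᵘ p ≃ᵘ mkℚᵘ (ℤ.+ n) (pred d) → Coprime n d → ↧ₙ p ≡ d
↧ₙ-≃ᵘ-coprime {p} {n} {d} p≃n/d c = trans (cong ↧ₙ_ p≡n/d) (↧ₙ-/-coprime n d c)
  where
  p≡n/d : p ≡ ℤ.+ n /ℚ d
  p≡n/d = ℚ.toℚᵘ-injective (ℚᵘ.≃-trans p≃n/d (ℚᵘ.≃-sym (toℚᵘ-/ n d)))

↧ₙ-vdc : ∀ m → ↧ₙ (vdc m) ≡ 2 ^ length (bitsLSB m)
↧ₙ-vdc m = ↧ₙ-≃ᵘ-coprime {{m^n≢0 2 (length (bitsLSB m))}}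
  (toℚᵘ-vdcSum 0 (bitsLSB m)) (numeral-coprime (numeral-bitsLSB m))

-- BallotPath h n w: read from its end (most significant digit first), w is a path of
-- up-steps 1 and down-steps 0 that never drops below height 0, has n down-steps and ends
-- at height h.
data BallotPath : ℕ → ℕ → List ℕ → Set where
  []   : BallotPath 0 0 []
  up   : ∀ {h n w} → BallotPath h n w → BallotPath (suc h) n (1 ∷ w)
  down : ∀ {h n w} → BallotPath (suc h) n w → BallotPath h (suc n) (0 ∷ w)

path-numeral : ∀ {h n w} → BallotPath h n w → Numeral w
path-numeral []                   = []
path-numeral (up {w = []} _)       = [1]
path-numeral (up {w = _ ∷ _} p)    = bit1 ∷ path-numeral p
path-numeral (down {w = _ ∷ _} p) = bit0 ∷ path-numeral p

path-zeros : ∀ {h n w} → BallotPath h n w → zeros w ≡ n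
path-zeros []       = refl
path-zeros (up p)   = path-zeros p
path-zeros (down p) = cong suc (path-zeros p)

path-ones : ∀ {h n w} → BallotPath h n w → ones w ≡ h + n
path-ones []               = refl
path-ones (up p)           = cong suc (path-ones p)
path-ones (down {h} {n} p) = trans (path-ones p) (sym (+-suc h n))

path-nonnegative : ∀ {h n w} → BallotPath h n w → Nonnegative w
path-nonnegative {h} {n} p = subst₂ _≤_ (sym (path-zeros p)) (sym (path-ones p)) (m≤n+m n h)

path⇒prefixNonnegative : ∀ {h n w} → BallotPath h n w → PrefixNonnegative (reverse w)
path⇒prefixNonnegative []                = prefixNonnegative-[]
path⇒prefixNonnegative p@(up {w = w} q)   =
  prefixNonnegative-reverse-∷⁺ 1 w (path⇒prefixNonnegative q) (path-nonnegative p)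
path⇒prefixNonnegative p@(down {w = w} q) =
  prefixNonnegative-reverse-∷⁺ 0 w (path⇒prefixNonnegative q) (path-nonnegative p)

prefixNonnegative⇒path : ∀ {h w} → All IsBit w → PrefixNonnegative (reverse w) →
                         ones w ≡ h + zeros w → BallotPath h (zeros w) w
prefixNonnegative⇒path {zero}  []  _ _ = []
prefixNonnegative⇒path {suc _} []  _ ()
prefixNonnegative⇒path {zero} {_ ∷ w} (bit1 ∷ _) pn 1+o≡z =
  contradiction (subst (_≤ ones w) (sym 1+o≡z) z≤o) 1+n≰n
  where
  -- an up-step ending at height 0 would have to start at height -1
  z≤o : zeros w ≤ ones w
  z≤o = nonnegative-reverse⁻ w (prefixNonnegative⇒nonnegative (prefixNonnegative-reverse-∷⁻ 1 w pn))
prefixNonnegative⇒path {suc h} {_ ∷ w} (bit1 ∷ βs) pn o≡h+z =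
  up (prefixNonnegative⇒path βs (prefixNonnegative-reverse-∷⁻ 1 w pn) (suc-injective o≡h+z))
prefixNonnegative⇒path {h} {_ ∷ w} (bit0 ∷ βs) pn o≡h+z =
  down (prefixNonnegative⇒path βs (prefixNonnegative-reverse-∷⁻ 0 w pn)
    (trans o≡h+z (+-suc h (zeros w))))

path⇒dyck : ∀ {k w} → BallotPath 0 k w → Dyck k (reverse w)
path⇒dyck {k} {w} p =
    trans (length-reverse w) (trans (length≡ones+zeros (numeral⇒bits (path-numeral p)))
      (cong₂ _+_ (path-ones p) (trans (path-zeros p) (sym (+-identityʳ k)))))
  , trans (ones-reverse w) (path-ones p)
  , trans (zeros-reverse w) (path-zeros p)
  , path⇒prefixNonnegative p

dyck⇒path : ∀ {k w} → All IsBit w → Dyck k (reverse w) → BallotPath 0 k w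
dyck⇒path {k} {w} βs (_ , o≡k , z≡k , pn) =
  subst (λ n → BallotPath 0 n w) z′≡k (prefixNonnegative⇒path βs pn (trans o′≡k (sym z′≡k)))
  where
  o′≡k : ones w ≡ k
  o′≡k = trans (sym (ones-reverse w)) o≡k
  z′≡k : zeros w ≡ k
  z′≡k = trans (sym (zeros-reverse w)) z≡k

-- Enumerating and counting ballot paths

map-∷-disjoint : ∀ {A : Set} {x y : A} {xss yss} → x ≢ y →
                 Disjoint (map (x ∷_) xss) (map (y ∷_) yss)
map-∷-disjoint x≢y (v∈xs , v∈ys) with ∈-map⁻ _ v∈xs | ∈-map⁻ _ v∈ys
... | _ , _ , refl | _ , _ , eq = x≢y (∷-injectiveˡ eq)

paths : ℕ → ℕ → List (List ℕ)
paths zero    zero    = [ [] ]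
paths (suc h) zero    = map (1 ∷_) (paths h zero)
paths zero    (suc n) = map (0 ∷_) (paths 1 n)
paths (suc h) (suc n) = map (1 ∷_) (paths h (suc n)) ++ map (0 ∷_) (paths (suc (suc h)) n)

paths-sound : ∀ h n {w} → w ∈ paths h n → BallotPath h n w
paths-sound zero    zero    (here refl) = []
paths-sound (suc h) zero    w∈ with ∈-map⁻ (1 ∷_) w∈
... | _ , v∈ , refl = up (paths-sound h zero v∈)
paths-sound zero    (suc n) w∈ with ∈-map⁻ (0 ∷_) w∈
... | _ , v∈ , refl = down (paths-sound 1 n v∈)
paths-sound (suc h) (suc n) w∈ with ∈-++⁻ (map (1 ∷_) (paths h (suc n))) w∈
... | inj₁ w∈ups with ∈-map⁻ (1 ∷_) w∈ups
...   | _ , v∈ , refl = up (paths-sound h (suc n) v∈)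
paths-sound (suc h) (suc n) w∈ | inj₂ w∈downs with ∈-map⁻ (0 ∷_) w∈downs
...   | _ , v∈ , refl = down (paths-sound (suc (suc h)) n v∈)

paths-complete : ∀ {h n w} → BallotPath h n w → w ∈ paths h n
paths-complete []                     = here refl
paths-complete (up {n = zero} p)      = ∈-map⁺ (1 ∷_) (paths-complete p)
paths-complete (up {n = suc n} p)     = ∈-++⁺ˡ (∈-map⁺ (1 ∷_) (paths-complete p))
paths-complete (down {h = zero} p)    = ∈-map⁺ (0 ∷_) (paths-complete p)
paths-complete (down {h = suc h} {n} p) =
  ∈-++⁺ʳ (map (1 ∷_) (paths h (suc n))) (∈-map⁺ (0 ∷_) (paths-complete p))

paths-unique : ∀ h n → Unique (paths h n)
paths-unique zero    zero    = [] ∷ []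
paths-unique (suc h) zero    = Unique.map⁺ ∷-injectiveʳ (paths-unique h zero)
paths-unique zero    (suc n) = Unique.map⁺ ∷-injectiveʳ (paths-unique 1 n)
paths-unique (suc h) (suc n) = Unique.++⁺
  (Unique.map⁺ ∷-injectiveʳ (paths-unique h (suc n)))
  (Unique.map⁺ ∷-injectiveʳ (paths-unique (suc (suc h)) n))
  (map-∷-disjoint λ ())

length-paths-0 : ∀ h → length (paths h 0) ≡ 1
length-paths-0 zero    = refl
length-paths-0 (suc h) = trans (length-map (1 ∷_) (paths h 0)) (length-paths-0 h)

pascal-step : ∀ {L₁ L₂} N j k → L₁ + N C k ≡ N C suc j → L₂ + N C suc k ≡ N C j →
              (L₁ + L₂) + suc N C suc k ≡ suc N C suc j
pascal-step {L₁} {L₂} N j k e₁ e₂ = begin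
  (L₁ + L₂) + suc N C suc k         ≡⟨ cong ((L₁ + L₂) +_) (nCk+nC[k+1]≡[n+1]C[k+1] N k) ⟨
  (L₁ + L₂) + (N C k + N C suc k)   ≡⟨ interchange +-commutativeSemigroup L₁ L₂ (N C k) (N C suc k) ⟩
  (L₁ + N C k) + (L₂ + N C suc k)   ≡⟨ cong₂ _+_ e₁ e₂ ⟩
  N C suc j + N C j                 ≡⟨ +-comm (N C suc j) (N C j) ⟩
  N C j + N C suc j                 ≡⟨ nCk+nC[k+1]≡[n+1]C[k+1] N j ⟩
  suc N C suc j                     ∎
  where open ≡-Reasoning

-- The ballot formula #paths = C(N, n) - C(N, n - 1) with N = h + 2n, where C(N, n - 1) is
-- written as C(N, h + n + 1) so that it vanishes for n = 0.
ballot-count : ∀ h n → length (paths h n) + (h + 2 * n) C suc (h + n) ≡ (h + 2 * n) C n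
ballot-count h zero = cong₂ _+_ (length-paths-0 h) (k>n⇒nCk≡0 (n<1+n (h + 0)))
ballot-count zero (suc n) = begin
  length (map (0 ∷_) (paths 1 n)) + 2 * suc n C (2 + n)
    ≡⟨ cong₂ (λ L N → L + N C (2 + n)) (length-map (0 ∷_) (paths 1 n)) (*-suc 2 n) ⟩
  length (paths 1 n) + (2 + 2 * n) C (2 + n)
    ≡⟨ pascal-step (1 + 2 * n) n (suc n) refl (ballot-count 1 n) ⟩
  (2 + 2 * n) C suc n
    ≡⟨ cong (_C suc n) (*-suc 2 n) ⟨
  2 * suc n C suc n ∎
  where open ≡-Reasoning
ballot-count (suc h) (suc n) = begin
  length (ups ++ downs) + suc N C suc k
    ≡⟨ cong (_+ suc N C suc k) length-ups++downs ⟩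
  (length (paths h (suc n)) + length (paths (2 + h) n)) + suc N C suc k
    ≡⟨ pascal-step N n k (ballot-count h (suc n)) count-downs ⟩
  suc N C suc n ∎
  where
  open ≡-Reasoning
  N = h + 2 * suc n
  k = suc (h + suc n)
  ups   = map (1 ∷_) (paths h (suc n))
  downs = map (0 ∷_) (paths (2 + h) n)
  length-ups++downs : length (ups ++ downs) ≡ length (paths h (suc n)) + length (paths (2 + h) n)
  length-ups++downs = trans (length-++ ups)
    (cong₂ _+_ (length-map (1 ∷_) (paths h (suc n))) (length-map (0 ∷_) (paths (2 + h) n)))
  2+h+2n≡N : 2 + h + 2 * n ≡ N
  2+h+2n≡N = sym (begin
    h + 2 * suc n         ≡⟨ cong (h +_) (*-suc 2 n) ⟩
    h + suc (suc (2 * n)) ≡⟨ +-suc h (suc (2 * n)) ⟩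
    suc (h + suc (2 * n)) ≡⟨ cong suc (+-suc h (2 * n)) ⟩
    2 + h + 2 * n         ∎)
  count-downs : length (paths (2 + h) n) + N C suc k ≡ N C n
  count-downs = subst₂ (λ M i → length (paths (2 + h) n) + M C i ≡ M C n)
    2+h+2n≡N (cong (suc ∘ suc) (sym (+-suc h n))) (ballot-count (2 + h) n)

nCk*k!*[n∸k]!≡n! : ∀ {n k} → k ≤ n → (n C k) * (k ! * (n ∸ k) !) ≡ n !
nCk*k!*[n∸k]!≡n! {n} {k} k≤n = trans (cong (_* (k ! * (n ∸ k) !)) (nCk≡n!/k![n-k]! k≤n))
  (m/n*n≡m {{k !* (n ∸ k) !≢0}} (k![n∸k]!∣n! k≤n))

nC[1+k]*[1+k]≡nCk*[n∸k] : ∀ n k → (n C suc k) * suc k ≡ (n C k) * (n ∸ k)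
nC[1+k]*[1+k]≡nCk*[n∸k] n k with k <? n
... | no k≮n = begin
  (n C suc k) * suc k ≡⟨ cong (_* suc k) (k>n⇒nCk≡0 (s≤s (≮⇒≥ k≮n))) ⟩
  0                   ≡⟨ *-zeroʳ (n C k) ⟨
  (n C k) * 0         ≡⟨ cong ((n C k) *_) (m≤n⇒m∸n≡0 (≮⇒≥ k≮n)) ⟨
  (n C k) * (n ∸ k)   ∎
  where open ≡-Reasoning
... | yes k<n = *-cancelʳ-≡ _ _ (k ! * (n ∸ suc k) !) {{k !* (n ∸ suc k) !≢0}} (begin
  (n C suc k) * suc k * (k ! * (n ∸ suc k) !)
    ≡⟨ regroup (n C suc k) (suc k) (k !) ((n ∸ suc k) !) ⟨
  (n C suc k) * (suc k ! * (n ∸ suc k) !)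
    ≡⟨ nCk*k!*[n∸k]!≡n! k<n ⟩
  n !
    ≡⟨ nCk*k!*[n∸k]!≡n! (<⇒≤ k<n) ⟨
  (n C k) * (k ! * (n ∸ k) !)
    ≡⟨ cong (λ f → (n C k) * (k ! * f)) ([n-k]*[n-k-1]!≡[n-k]! k<n) ⟨
  (n C k) * (k ! * ((n ∸ k) * (n ∸ suc k) !))
    ≡⟨ regroup′ (n C k) (n ∸ k) (k !) ((n ∸ suc k) !) ⟩
  (n C k) * (n ∸ k) * (k ! * (n ∸ suc k) !) ∎)
  where
  open ≡-Reasoning
  regroup : ∀ c s f r → c * (s * f * r) ≡ c * s * (f * r)
  regroup = solve-∀
  regroup′ : ∀ c d f r → c * (f * (d * r)) ≡ c * d * (f * r)
  regroup′ = solve-∀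

catalan≡length-paths : ∀ k → catalan k ≡ length (paths 0 k)
catalan≡length-paths k = begin
  catalan k               ≡⟨ cong (_/ suc k) L*[1+k]≡2kCk ⟨
  L * suc k / suc k       ≡⟨ m*n/n≡m L (suc k) ⟩
  L                       ∎
  where
  open ≡-Reasoning
  L = length (paths 0 k)
  c = 2 * k C k
  c′ = 2 * k C suc k
  2k∸k≡k : 2 * k ∸ k ≡ k
  2k∸k≡k = trans (m+n∸m≡n k (k + 0)) (+-identityʳ k)
  c′*[1+k]≡c*k : c′ * suc k ≡ c * k
  c′*[1+k]≡c*k = trans (nC[1+k]*[1+k]≡nCk*[n∸k] (2 * k) k) (cong (c *_) 2k∸k≡k)
  L*[1+k]≡2kCk : L * suc k ≡ c
  L*[1+k]≡2kCk = +-cancelʳ-≡ (c * k) (L * suc k) c (begin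
    L * suc k + c * k       ≡⟨ cong (L * suc k +_) c′*[1+k]≡c*k ⟨
    L * suc k + c′ * suc k  ≡⟨ *-distribʳ-+ (suc k) L c′ ⟨
    (L + c′) * suc k        ≡⟨ cong (_* suc k) (ballot-count 0 k) ⟩
    c * suc k               ≡⟨ *-suc c k ⟩
    c + c * k               ∎)

^-injectiveʳ : ∀ {m a b} → 1 < m → m ^ a ≡ m ^ b → a ≡ b
^-injectiveʳ {m} {a} {b} 1<m mᵃ≡mᵇ with <-cmp a b
... | tri< a<b _ _ = contradiction mᵃ≡mᵇ (<⇒≢ (^-monoʳ-< m 1<m a<b))
... | tri≈ _ a≡b _ = a≡b
... | tri> _ _ a>b = contradiction mᵃ≡mᵇ (>⇒≢ (^-monoʳ-< m 1<m a>b))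

unique-map-retraction : ∀ {A B : Set} {f : A → B} (g : B → A) {xs} →
                        All (λ x → g (f x) ≡ x) xs → Unique xs → Unique (map f xs)
unique-map-retraction g {xs} g∘f≡id u =
  Unique.map⁻ {f = g} (subst Unique (sym (trans (sym (map-∘ xs)) (map-id-local g∘f≡id))) u)

↧ₙ-vdc-dyck : ∀ {k} m → Dyck k (bitsMSB m) → ↧ₙ (vdc m) ≡ 4 ^ k
↧ₙ-vdc-dyck {k} m (length≡2k , _) = begin
  ↧ₙ (vdc m)             ≡⟨ ↧ₙ-vdc m ⟩
  2 ^ length (bitsLSB m) ≡⟨ cong (2 ^_) (trans (sym (length-reverse (bitsLSB m))) length≡2k) ⟩
  2 ^ (2 * k)            ≡⟨ ^-*-assoc 2 2 k ⟨
  4 ^ k                  ∎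
  where open ≡-Reasoning

path⇒totallyBalanced : ∀ {k w} → BallotPath 0 (suc k) w →
                       TotallyBalanced (fromBits w) × ↧ₙ (vdc (fromBits w)) ≡ 4 ^ suc k
path⇒totallyBalanced {k} {w} p@(down _) =
  (fromBits-pos (path-numeral p) , suc k , dyck) , ↧ₙ-vdc-dyck (fromBits w) dyck
  where
  dyck : Dyck (suc k) (bitsMSB (fromBits w))
  dyck = subst (Dyck (suc k) ∘ reverse) (sym (bitsLSB-fromBits (path-numeral p))) (path⇒dyck p)

totallyBalanced⇒path : ∀ {k m} → TotallyBalanced m → ↧ₙ (vdc m) ≡ 4 ^ k →
                       BallotPath 0 k (bitsLSB m)
totallyBalanced⇒path {k} {m} (_ , j , dyck) ↧ₙvdc≡4ᵏ =
  subst (λ n → BallotPath 0 n (bitsLSB m)) j≡k (dyck⇒path (numeral⇒bits (numeral-bitsLSB m)) dyck)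
  where
  j≡k : j ≡ k
  j≡k = ^-injectiveʳ {4} (s≤s (s≤s z≤n)) (trans (sym (↧ₙ-vdc-dyck m dyck)) ↧ₙvdc≡4ᵏ)

∈-totallyBalanced⇔ : ∀ k m →
  m ∈ map fromBits (paths 0 (suc k)) ⇔ (TotallyBalanced m × ↧ₙ (vdc m) ≡ 4 ^ suc k)
∈-totallyBalanced⇔ k m = mk⇔ to from
  where
  to : m ∈ map fromBits (paths 0 (suc k)) → TotallyBalanced m × ↧ₙ (vdc m) ≡ 4 ^ suc k
  to m∈ with ∈-map⁻ fromBits m∈
  ... | _ , w∈ , refl = path⇒totallyBalanced {k} (paths-sound 0 (suc k) w∈)
  from : TotallyBalanced m × ↧ₙ (vdc m) ≡ 4 ^ suc k → m ∈ map fromBits (paths 0 (suc k))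
  from (tb , ↧ₙvdc≡4ᵏ) = subst (_∈ map fromBits (paths 0 (suc k))) (fromBits-bitsLSB m)
    (∈-map⁺ fromBits (paths-complete (totallyBalanced⇒path {suc k} tb ↧ₙvdc≡4ᵏ)))

proposition1 : ((m : ℕ) → TotallyBalanced m → ∃ λ j → ↧ₙ (vdc m) ≡ 4 ^ j)
    × ((k : ℕ) → 1 ≤ k →
        Σ (List ℕ) λ ms →
          Unique ms
          × ((m : ℕ) → (m ∈ ms) ⇔ (TotallyBalanced m × ↧ₙ (vdc m) ≡ 4 ^ k))
          × length ms ≡ catalan k)
proposition1 =
    (λ { m (_ , k , dyck) → k , ↧ₙ-vdc-dyck m dyck })
  , λ { (suc k) _ →
          map fromBits (paths 0 (suc k))
        , unique-map-retraction bitsLSB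
            (All.tabulate (bitsLSB-fromBits ∘ path-numeral ∘ paths-sound 0 (suc k)))
            (paths-unique 0 (suc k))
        , ∈-totallyBalanced⇔ k
        , trans (length-map fromBits (paths 0 (suc k))) (sym (catalan≡length-paths (suc k))) }
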